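{- Let $Q$ be a query over a $\lambda$-graph $G$. Then $Q^{\Downarrow}$ is an open bisimulation if and only if $[\![n]\!]=[\![m]\!]$ for all nodes $n,m$ with $n\mathrel{Q}m$.
   Context: A $\lambda$-graph: finite directed graph with application nodes $\mathrm{App}(n_1,n_2)$ (left child $n_1$, direction $\swarrow$; right child $n_2$, direction $\searrow$), abstraction nodes $\mathrm{Abs}(n)$ (child $n$, direction $\downarrow$), free variable nodes (no children; each carries an atom $\mathrm{id}(n)$, distinct nodes distinct atoms), bound variable nodes $\mathrm{Var}(l)$ with a binding edge to an abstraction node $l$. Traces are finite sequences of directions; $d\cdot\tau$ is $\tau$ followed by $d$. Paths: $n\xrightarrow{\epsilon}n$; if $n\xrightarrow{\tau}\mathrm{Abs}(m)$ then $n\xrightarrow{\downarrow\cdot\tau}m$; if $n\xrightarrow{\tau}\mathrm{App}(m_1,m_2)$ then $n\xrightarrow{\swarrow\cdot\tau}m_1$, $n\xrightarrow{\searrow\cdot\tau}m_2$. A root is a node whose only incoming path has empty trace. A path crosses $m$ if it ends at $m$ or extends a path crossing $m$. The graph is acyclic (paths from a node to itself have empty trace) and every path from a root to $\mathrm{Var}(l)$ crosses $l$. Locally nameless terms: $t::=\underline k\mid x\mid t\,t\mid\lambda t$. Index: $\mathrm{idx}_l(n\xrightarrow{\tau}l)=0$; $\mathrm{idx}_l(n\xrightarrow{d\cdot\tau}l')=\mathrm{idx}_l(n\xrightarrow{\tau})+1$ if $l'\ne l$ is an abstraction node; $\mathrm{idx}_l(n\xrightarrow{d\cdot\tau}p)=\mathrm{idx}_l(n\xrightarrow{\tau})$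 otherwise. Readback from a root $r$: $[\![r\xrightarrow{\tau}\mathrm{Var}(l)]\!]=\underline{\mathrm{idx}_l(r\xrightarrow{\tau})}$; free variable $n$ reads back as $\mathrm{id}(n)$; $[\![r\xrightarrow{\tau}\mathrm{Abs}(m)]\!]=\lambda[\![r\xrightarrow{\downarrow\cdot\tau}m]\!]$; $[\![r\xrightarrow{\tau}\mathrm{App}(n_1,n_2)]\!]=[\![r\xrightarrow{\swarrow\cdot\tau}n_1]\!]\,[\![r\xrightarrow{\searrow\cdot\tau}n_2]\!]$; $[\![r]\!]=[\![r\xrightarrow{\epsilon}r]\!]$. A query is a binary relation on the roots of $G$. Nodes are homogeneous if of the same kind. A bisimulation is a homogeneous relation closed under $\mathrm{App}(n_1,n_2)\,R\,\mathrm{App}(m_1,m_2)\Rightarrow n_1Rm_1,n_2Rm_2$; $\mathrm{Abs}(n)\,R\,\mathrm{Abs}(m)\Rightarrow nRm$; $\mathrm{Var}(n)\,R\,\mathrm{Var}(m)\Rightarrow nRm$. It is open if it relates two free variable nodes only when they are equal. $Q^{\Downarrow}$ is the closure of $Q$ under the $\mathrm{App}$ and $\mathrm{Abs}$ rules. -}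

module Defs where

open import Data.Nat using (ℕ; zero; suc)
open import Data.Fin using (Fin; _≟_)
open import Data.Bool using (Bool; true; false; if_then_else_)
open import Data.List using (List; []; _∷_)
open import Data.Product using (Σ; ∃; _×_; _,_)
open import Relation.Binary.PropositionalEquality using (_≡_)
open import Relation.Nullary.Decidable using (⌊_⌋)

Atom : Set
Atom = ℕ

data Node (N : ℕ) : Set where
  App  : Fin N → Fin N → Node N
  Abs  : Fin N → Node N
  FVar : Atom → Node N
  Var  : Fin N → Node N           -- bound variable, binding edge to l

data Kind : Set where
  kApp kAbs kFVar kVar : Kind

kindOf : ∀ {N} → Node N → Kind
kindOf (App _ _) = kApp
kindOf (Abs _)   = kAbs
kindOf (FVar _)  = kFVar
kindOf (Var _)   = kVar

isAbs : ∀ {N} → Node N → Bool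
isAbs (Abs _) = true
isAbs _       = false

data Dir : Set where
  ↙ ↘ ↓ : Dir

-- Traces: d ∷ τ represents d · τ (τ followed by d).
Trace : Set
Trace = List Dir

-- Locally nameless terms.
data Term : Set where
  bv  : ℕ → Term
  fv  : Atom → Term
  _·_ : Term → Term → Term
  ƛ   : Term → Term

module _ {N : ℕ} (kind : Fin N → Node N) where

  data Path (n : Fin N) : Trace → Fin N → Set where
    ε     : Path n [] n
    down  : ∀ {τ p m} → Path n τ p → kind p ≡ Abs m → Path n (↓ ∷ τ) m
    left  : ∀ {τ p m₁ m₂} → Path n τ p → kind p ≡ App m₁ m₂ → Path n (↙ ∷ τ) m₁
    right : ∀ {τ p m₁ m₂} → Path n τ p → kind p ≡ App m₁ m₂ → Path n (↘ ∷ τ) m₂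

  IsRoot : Fin N → Set
  IsRoot r = ∀ {n τ} → Path n τ r → τ ≡ []

  data Crosses {n : Fin N} : ∀ {τ m} → Path n τ m → Fin N → Set where
    ends      : ∀ {τ m} (p : Path n τ m) → Crosses p m
    ext-down  : ∀ {τ p m x} {q : Path n τ p} (e : kind p ≡ Abs m) →
                Crosses q x → Crosses (down q e) x
    ext-left  : ∀ {τ p m₁ m₂ x} {q : Path n τ p} (e : kind p ≡ App m₁ m₂) →
                Crosses q x → Crosses (left q e) x
    ext-right : ∀ {τ p m₁ m₂ x} {q : Path n τ p} (e : kind p ≡ App m₁ m₂) →
                Crosses q x → Crosses (right q e) x

  stepIdx : Fin N → Fin N → ℕ → ℕ
  stepIdx l q k = if ⌊ q ≟ l ⌋ then 0 else (if isAbs (kind q) then suc k else k)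

  -- idx_l(n --τ--> m); the value on paths not crossing l is irrelevant (0)
  idx : ∀ {n τ m} → Fin N → Path n τ m → ℕ
  idx l ε                        = 0
  idx l (down  {m = q} p _)      = stepIdx l q (idx l p)
  idx l (left  {m₁ = q} p _)     = stepIdx l q (idx l p)
  idx l (right {m₂ = q} p _)     = stepIdx l q (idx l p)

  -- Readback, as the graph of the (recursive) readback function:
  -- Readback p t  means  [[ p ]] = t
  data Readback {r : Fin N} : ∀ {τ n} → Path r τ n → Term → Set where
    rb-var : ∀ {τ n l} {p : Path r τ n} → kind n ≡ Var l →
             Readback p (bv (idx l p))
    rb-fv  : ∀ {τ n a} {p : Path r τ n} → kind n ≡ FVar a →
             Readback p (fv a)
    rb-abs : ∀ {τ n m t} {p : Path r τ n} (e : kind n ≡ Abs m) →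
             Readback (down p e) t → Readback p (ƛ t)
    rb-app : ∀ {τ n m₁ m₂ t₁ t₂} {p : Path r τ n} (e : kind n ≡ App m₁ m₂) →
             Readback (left p e) t₁ → Readback (right p e) t₂ →
             Readback p (t₁ · t₂)

record LambdaGraph (N : ℕ) : Set where
  field
    kind     : Fin N → Node N
    fvar-inj : ∀ {n m a} → kind n ≡ FVar a → kind m ≡ FVar a → n ≡ m
    bind-abs : ∀ {v l} → kind v ≡ Var l → ∃ λ m → kind l ≡ Abs m
    acyclic  : ∀ {n τ} → Path kind n τ n → τ ≡ []
    scoped   : ∀ {r τ v l} → IsRoot kind r → (p : Path kind r τ v) →
               kind v ≡ Var l → Crosses kind p l

module _ {N : ℕ} (G : LambdaGraph N) where
  open LambdaGraph G

  ReadbackRoot : Fin N → Term → Set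
  ReadbackRoot r t = Readback kind (ε {n = r}) t

  IsQuery : (Fin N → Fin N → Set) → Set
  IsQuery Q = ∀ {n m} → Q n m → IsRoot kind n × IsRoot kind m

  data _⇓ (Q : Fin N → Fin N → Set) : Fin N → Fin N → Set where
    base  : ∀ {n m} → Q n m → (Q ⇓) n m
    appL  : ∀ {n m n₁ n₂ m₁ m₂} → (Q ⇓) n m → kind n ≡ App n₁ n₂ →
            kind m ≡ App m₁ m₂ → (Q ⇓) n₁ m₁
    appR  : ∀ {n m n₁ n₂ m₁ m₂} → (Q ⇓) n m → kind n ≡ App n₁ n₂ →
            kind m ≡ App m₁ m₂ → (Q ⇓) n₂ m₂
    abs   : ∀ {n m n' m'} → (Q ⇓) n m → kind n ≡ Abs n' →
            kind m ≡ Abs m' → (Q ⇓) n' m'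

  Homogeneous : (Fin N → Fin N → Set) → Set
  Homogeneous R = ∀ {n m} → R n m → kindOf (kind n) ≡ kindOf (kind m)

  record IsBisimulation (R : Fin N → Fin N → Set) : Set where
    field
      homogeneous : Homogeneous R
      app-closed  : ∀ {n m n₁ n₂ m₁ m₂} → R n m → kind n ≡ App n₁ n₂ →
                    kind m ≡ App m₁ m₂ → R n₁ m₁ × R n₂ m₂
      abs-closed  : ∀ {n m n' m'} → R n m → kind n ≡ Abs n' →
                    kind m ≡ Abs m' → R n' m'
      var-closed  : ∀ {n m l l'} → R n m → kind n ≡ Var l →
                    kind m ≡ Var l' → R l l'

  record IsOpenBisimulation (R : Fin N → Fin N → Set) : Set where
    field
      bisim : IsBisimulation R
      open′ : ∀ {n m a b} → R n m → kind n ≡ FVar a → kind m ≡ FVar b → n ≡ m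

-- Both directions compare the graph along parallel paths (same trace, starting
-- at the two nodes of a related pair).
--  * Paths: acyclicity and finiteness bound every path length by N, so
--    readback (recursion along paths) always terminates.
--  * Descending relations (homogeneous, closed under the App/Abs rules) relate
--    endpoints of parallel paths and transport paths both ways; iterating the
--    transport shows they never relate a node to two nodes one of which properly
--    descends from the other.  Hence along parallel paths a binder is reached
--    exactly when its partner is: indices agree, and equal indices mean related binders.
--  * (⇒) Readbacks exist; an open bisimulation makes parallel readbacks equal.
--  * (⇐) Every Q⇓-pair ends parallel paths from a Q-pair; their equal readbacks give
--    homogeneity, related binders and equal free variable nodes.
module Submission where

open import Defs
open import Data.Nat using (ℕ; zero; suc; _+_; _≤_; _<_; z≤n; s≤s)
open import Data.Nat.Properties using (<⇒≱; +-suc; m≤m+n; ≤-trans; 0≢1+n; suc-injective)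
open import Data.Fin using (Fin; _≟_) renaming (zero to fzero; suc to fsuc)
open import Data.Fin.Properties using (injective⇒≤)
open import Data.Bool using (Bool; true; false; if_then_else_)
open import Data.List using ([]; _∷_; length; _++_)
open import Data.List.Properties using (length-++-sucʳ; length-++-≤ˡ)
open import Data.Product using (∃; ∃₂; _×_; _,_; proj₁; proj₂)
open import Data.Sum using (_⊎_; inj₁; inj₂)
open import Data.Empty using (⊥; ⊥-elim)
open import Function using (flip; _∘_)
open import Function.Bundles using (_⇔_; mk⇔)
open import Relation.Nullary using (¬_; yes; no)
open import Relation.Binary.PropositionalEquality
  using (_≡_; _≢_; refl; sym; trans; cong; cong₂; subst)
open import Axiom.UniquenessOfIdentityProofs.WithK using (uip)

sameKind-App : ∀ {N} {u v : Node N} {x₁ x₂} → kindOf u ≡ kindOf v →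
               u ≡ App x₁ x₂ → ∃₂ λ y₁ y₂ → v ≡ App y₁ y₂
sameKind-App {v = App _ _} _  refl = _ , _ , refl
sameKind-App {v = Abs _}   () refl
sameKind-App {v = FVar _}  () refl
sameKind-App {v = Var _}   () refl

sameKind-Abs : ∀ {N} {u v : Node N} {x} → kindOf u ≡ kindOf v →
               u ≡ Abs x → ∃ λ y → v ≡ Abs y
sameKind-Abs {v = App _ _} () refl
sameKind-Abs {v = Abs _}   _  refl = _ , refl
sameKind-Abs {v = FVar _}  () refl
sameKind-Abs {v = Var _}   () refl

sameKind-FVar : ∀ {N} {u v : Node N} {a} → kindOf u ≡ kindOf v →
                u ≡ FVar a → ∃ λ b → v ≡ FVar b
sameKind-FVar {v = App _ _} () refl
sameKind-FVar {v = Abs _}   () refl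
sameKind-FVar {v = FVar _}  _  refl = _ , refl
sameKind-FVar {v = Var _}   () refl

sameKind-Var : ∀ {N} {u v : Node N} {l} → kindOf u ≡ kindOf v →
               u ≡ Var l → ∃ λ l' → v ≡ Var l'
sameKind-Var {v = App _ _} () refl
sameKind-Var {v = Abs _}   () refl
sameKind-Var {v = FVar _}  () refl
sameKind-Var {v = Var _}   _  refl = _ , refl

isAbsKind : Kind → Bool
isAbsKind kAbs = true
isAbsKind _    = false

isAbs-via-kind : ∀ {N} (u : Node N) → isAbs u ≡ isAbsKind (kindOf u)
isAbs-via-kind (App _ _) = refl
isAbs-via-kind (Abs _)   = refl
isAbs-via-kind (FVar _)  = refl
isAbs-via-kind (Var _)   = refl

sameKind-isAbs : ∀ {N} {u v : Node N} → kindOf u ≡ kindOf v → isAbs u ≡ isAbs v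
sameKind-isAbs {u = u} {v} k =
  trans (isAbs-via-kind u) (trans (cong isAbsKind k) (sym (isAbs-via-kind v)))

tick : Bool → ℕ → ℕ
tick b k = if b then suc k else k

tick-true : ∀ {b} k → b ≡ true → tick b k ≡ suc k
tick-true k refl = refl

tick-injective : ∀ {b b' k k'} → b ≡ b' → tick b k ≡ tick b' k' → k ≡ k'
tick-injective {true}  refl = suc-injective
tick-injective {false} refl = λ eq → eq

bv-injective : ∀ {i j} → bv i ≡ bv j → i ≡ j
bv-injective refl = refl

fv-injective : ∀ {a b} → fv a ≡ fv b → a ≡ b
fv-injective refl = refl

termKind : Term → Kind
termKind (bv _)  = kVar
termKind (fv _)  = kFVar
termKind (_ · _) = kApp
termKind (ƛ _)   = kAbs

module _ {N : ℕ} (G : LambdaGraph N) where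
  open LambdaGraph G

  infix 4 _—[_]→_
  _—[_]→_ : Fin N → Trace → Fin N → Set
  x —[ τ ]→ y = Path kind x τ y

  -- Path concatenation (traces are stored latest direction first).
  _++ᵖ_ : ∀ {x y z τ σ} → x —[ τ ]→ y → y —[ σ ]→ z → x —[ σ ++ τ ]→ z
  p ++ᵖ ε         = p
  p ++ᵖ down  q e = down  (p ++ᵖ q) e
  p ++ᵖ left  q e = left  (p ++ᵖ q) e
  p ++ᵖ right q e = right (p ++ᵖ q) e

  crossed⇒reaches : ∀ {x τ y l} {p : x —[ τ ]→ y} → Crosses kind p l →
                    ∃ λ σ → l —[ σ ]→ y
  crossed⇒reaches (ends _) = [] , ε
  crossed⇒reaches (ext-down  e c) = _ , down  (proj₂ (crossed⇒reaches c)) e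
  crossed⇒reaches (ext-left  e c) = _ , left  (proj₂ (crossed⇒reaches c)) e
  crossed⇒reaches (ext-right e c) = _ , right (proj₂ (crossed⇒reaches c)) e

  strictly-crossed : ∀ {x τ y l} {p : x —[ τ ]→ y} → Crosses kind p l → y ≢ l →
                     ∃₂ λ d σ → l —[ d ∷ σ ]→ y
  strictly-crossed c y≢l with crossed⇒reaches c
  ... | []    , ε = ⊥-elim (y≢l refl)
  ... | d ∷ σ , q = d , σ , q

  crosses-before-↓ : ∀ {x τ y m l} {q : x —[ τ ]→ y} {e : kind y ≡ Abs m} →
                     Crosses kind (down q e) l → m ≢ l → Crosses kind q l
  crosses-before-↓ (ends _)       m≢l = ⊥-elim (m≢l refl)
  crosses-before-↓ (ext-down _ c) _   = c

  crosses-before-↙ : ∀ {x τ y m₁ m₂ l} {q : x —[ τ ]→ y} {e : kind y ≡ App m₁ m₂} →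
                     Crosses kind (left q e) l → m₁ ≢ l → Crosses kind q l
  crosses-before-↙ (ends _)       m≢l = ⊥-elim (m≢l refl)
  crosses-before-↙ (ext-left _ c) _   = c

  crosses-before-↘ : ∀ {x τ y m₁ m₂ l} {q : x —[ τ ]→ y} {e : kind y ≡ App m₁ m₂} →
                     Crosses kind (right q e) l → m₂ ≢ l → Crosses kind q l
  crosses-before-↘ (ends _)        m≢l = ⊥-elim (m≢l refl)
  crosses-before-↘ (ext-right _ c) _   = c

  crosses-ε : ∀ {r l} → Crosses kind (ε {n = r}) l → r ≡ l
  crosses-ε (ends _) = refl

  -- The nodes visited by a path, indexed from its endpoint backwards.
  nodeAt : ∀ {x τ y} → x —[ τ ]→ y → Fin (suc (length τ)) → Fin N
  nodeAt {y = y} _ fzero = y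
  nodeAt (down  q _) (fsuc i) = nodeAt q i
  nodeAt (left  q _) (fsuc i) = nodeAt q i
  nodeAt (right q _) (fsuc i) = nodeAt q i

  nodeAt-crossed : ∀ {x τ y} (p : x —[ τ ]→ y) i → Crosses kind p (nodeAt p i)
  nodeAt-crossed p fzero = ends p
  nodeAt-crossed (down  q e) (fsuc i) = ext-down  e (nodeAt-crossed q i)
  nodeAt-crossed (left  q e) (fsuc i) = ext-left  e (nodeAt-crossed q i)
  nodeAt-crossed (right q e) (fsuc i) = ext-right e (nodeAt-crossed q i)

  no-cycle : ∀ {y d σ} → ¬ (y —[ d ∷ σ ]→ y)
  no-cycle c with () ← acyclic c

  -- The endpoint of a nonempty path is not visited earlier (that would be a cycle).
  endpoint-fresh : ∀ {x τ y} (p : x —[ τ ]→ y) i → nodeAt p (fsuc i) ≢ y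
  endpoint-fresh ε ()
  endpoint-fresh (down  q e) i eq =
    no-cycle (down (proj₂ (crossed⇒reaches (subst (Crosses kind q) eq (nodeAt-crossed q i)))) e)
  endpoint-fresh (left  q e) i eq =
    no-cycle (left (proj₂ (crossed⇒reaches (subst (Crosses kind q) eq (nodeAt-crossed q i)))) e)
  endpoint-fresh (right q e) i eq =
    no-cycle (right (proj₂ (crossed⇒reaches (subst (Crosses kind q) eq (nodeAt-crossed q i)))) e)

  nodeAt-injective : ∀ {x τ y} (p : x —[ τ ]→ y) {i j} → nodeAt p i ≡ nodeAt p j → i ≡ j
  nodeAt-injective p {fzero}  {fzero}  _  = refl
  nodeAt-injective p {fzero}  {fsuc j} eq = ⊥-elim (endpoint-fresh p j (sym eq))
  nodeAt-injective p {fsuc i} {fzero}  eq = ⊥-elim (endpoint-fresh p i eq)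
  nodeAt-injective (down  q _) {fsuc i} {fsuc j} eq = cong fsuc (nodeAt-injective q eq)
  nodeAt-injective (left  q _) {fsuc i} {fsuc j} eq = cong fsuc (nodeAt-injective q eq)
  nodeAt-injective (right q _) {fsuc i} {fsuc j} eq = cong fsuc (nodeAt-injective q eq)

  -- Pigeonhole: every path in G is shorter than the number of nodes.
  path-length< : ∀ {x τ y} → x —[ τ ]→ y → length τ < N
  path-length< p = injective⇒≤ (nodeAt-injective p)

  record IsDescending (R : Fin N → Fin N → Set) : Set where
    field
      homogeneous : Homogeneous G R
      app-closed  : ∀ {n m n₁ n₂ m₁ m₂} → R n m → kind n ≡ App n₁ n₂ →
                    kind m ≡ App m₁ m₂ → R n₁ m₁ × R n₂ m₂
      abs-closed  : ∀ {n m n' m'} → R n m → kind n ≡ Abs n' →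
                    kind m ≡ Abs m' → R n' m'

  bisimulation⇒descending : ∀ {R} → IsBisimulation G R → IsDescending R
  bisimulation⇒descending B = record
    { homogeneous = homogeneous ; app-closed = app-closed ; abs-closed = abs-closed }
    where open IsBisimulation B

  converse-descending : ∀ {R} → IsDescending R → IsDescending (flip R)
  converse-descending D = record
    { homogeneous = sym ∘ homogeneous
    ; app-closed  = λ r e e' → app-closed r e' e
    ; abs-closed  = λ r e e' → abs-closed r e' e }
    where open IsDescending D

  module _ {R : Fin N → Fin N → Set} (D : IsDescending R) where
    open IsDescending D

    parallel : ∀ {x x' τ y y'} → R x x' → x —[ τ ]→ y → x' —[ τ ]→ y' → R y y'
    parallel r ε ε = r
    parallel r (down  p e) (down  p' e') = abs-closed (parallel r p p') e e'
    parallel r (left  p e) (left  p' e') = proj₁ (app-closed (parallel r p p') e e')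
    parallel r (right p e) (right p' e') = proj₂ (app-closed (parallel r p p') e e')

    transfer : ∀ {x x' τ y} → R x x' → x —[ τ ]→ y → ∃ λ y' → x' —[ τ ]→ y' × R y y'
    transfer r ε = _ , ε , r
    transfer r (down p e) with transfer r p
    ... | _ , p' , r' with sameKind-Abs (homogeneous r') e
    ... | _ , e' = _ , down p' e' , abs-closed r' e e'
    transfer r (left p e) with transfer r p
    ... | _ , p' , r' with sameKind-App (homogeneous r') e
    ... | _ , _ , e' = _ , left p' e' , proj₁ (app-closed r' e e')
    transfer r (right p e) with transfer r p
    ... | _ , p' , r' with sameKind-App (homogeneous r') e
    ... | _ , _ , e' = _ , right p' e' , proj₂ (app-closed r' e e')

  -- If a is related to b and to a proper descendant c of b, then transporting the
  -- path b → c back to a and forth to c yields the same situation one level deeper;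
  -- iterating gives paths from b of any length.
  unbounded-paths : ∀ {R} → IsDescending R → ∀ k {a b c d β} → R a b → R a c →
                    b —[ d ∷ β ]→ c → ∃₂ λ τ z → b —[ τ ]→ z × k ≤ length τ
  unbounded-paths _ zero {b = b} _ _ _ = [] , b , ε , z≤n
  unbounded-paths D (suc k) {d = d} {β} rab rac bc
    with transfer (converse-descending D) rab bc
  ... | a₁ , aa₁ , ra₁c with transfer D rac aa₁
  ... | c₁ , cc₁ , ra₁c₁ with unbounded-paths D k ra₁c ra₁c₁ cc₁
  ... | τ , z , cz , k≤τ =
    τ ++ d ∷ β , z , bc ++ᵖ cz ,
    subst (suc k ≤_) (sym (length-++-sucʳ τ d β)) (s≤s (≤-trans k≤τ (length-++-≤ˡ τ)))

  no-related-descendant : ∀ {R} → IsDescending R → ∀ {a b c d β} → R a b → R a c →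
                          ¬ (b —[ d ∷ β ]→ c)
  no-related-descendant D rab rac bc with unbounded-paths D N rab rac bc
  ... | _ , _ , p , N≤τ = <⇒≱ (path-length< p) N≤τ

  -- Along parallel paths crossing related binders l, l': reaching l at related
  -- nodes means reaching l' too (otherwise l' properly descends to a partner of l).
  binders-synchronised : ∀ {R} → IsDescending R →
    ∀ {r r' τ x x' l l'} {p : r —[ τ ]→ x} {p' : r' —[ τ ]→ x'} →
    R l l' → R x x' → Crosses kind p l → Crosses kind p' l' → x ≡ l → x' ≡ l'
  binders-synchronised D {x' = x'} {l' = l'} rl rx _ c' refl with x' ≟ l'
  ... | yes x'≡l' = x'≡l'
  ... | no  x'≢l' with strictly-crossed c' x'≢l'
  ... | _ , _ , l'x' = ⊥-elim (no-related-descendant D rl rx l'x')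

  stepIdx-cong : ∀ {x x' l l' : Fin N} {k k' : ℕ} → kindOf (kind x) ≡ kindOf (kind x') →
    (x ≡ l → x' ≡ l') → (x' ≡ l' → x ≡ l) → (x ≢ l → x' ≢ l' → k ≡ k') →
    stepIdx kind l x k ≡ stepIdx kind l' x' k'
  stepIdx-cong {x} {x'} {l} {l'} same ⇒ ⇐ rec with x ≟ l | x' ≟ l'
  ... | yes _   | yes _    = refl
  ... | yes x≡l | no  x'≢l' = ⊥-elim (x'≢l' (⇒ x≡l))
  ... | no  x≢l | yes x'≡l' = ⊥-elim (x≢l (⇐ x'≡l'))
  ... | no  x≢l | no  x'≢l' = cong₂ tick (sameKind-isAbs same) (rec x≢l x'≢l')

  stepIdx-inversion : ∀ {x x' l l' : Fin N} {k k' : ℕ} → kindOf (kind x) ≡ kindOf (kind x') →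
    isAbs (kind l) ≡ true → isAbs (kind l') ≡ true →
    stepIdx kind l x k ≡ stepIdx kind l' x' k' →
    (x ≡ l × x' ≡ l') ⊎ (x ≢ l × x' ≢ l' × k ≡ k')
  stepIdx-inversion {x} {x'} {l} {l'} {k} {k'} same abs-l abs-l' eq with x ≟ l | x' ≟ l'
  ... | yes x≡l | yes x'≡l' = inj₁ (x≡l , x'≡l')
  ... | yes refl | no _ =
    ⊥-elim (0≢1+n (trans eq (tick-true k' (trans (sym (sameKind-isAbs same)) abs-l))))
  ... | no _ | yes refl =
    ⊥-elim (0≢1+n (trans (sym eq) (tick-true k (trans (sameKind-isAbs same) abs-l'))))
  ... | no x≢l | no x'≢l' =
    inj₂ (x≢l , x'≢l' , tick-injective (sameKind-isAbs same) eq)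

  idx-agree : ∀ {R} → IsDescending R → ∀ {r r' τ x x' l l'}
    (p : r —[ τ ]→ x) (p' : r' —[ τ ]→ x') → R r r' →
    Crosses kind p l → Crosses kind p' l' → R l l' → idx kind l p ≡ idx kind l' p'
  idx-agree D ε ε _ _ _ _ = refl
  idx-agree D (down q e) (down q' e') rr c c' rl =
    stepIdx-cong (homogeneous rx) (binders-synchronised D rl rx c c')
      (binders-synchronised (converse-descending D) rl rx c' c)
      (λ m≢l m'≢l' → idx-agree D q q' rr (crosses-before-↓ c m≢l) (crosses-before-↓ c' m'≢l') rl)
    where open IsDescending D
          rx = parallel D rr (down q e) (down q' e')
  idx-agree D (left q e) (left q' e') rr c c' rl =
    stepIdx-cong (homogeneous rx) (binders-synchronised D rl rx c c')
      (binders-synchronised (converse-descending D) rl rx c' c)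
      (λ m≢l m'≢l' → idx-agree D q q' rr (crosses-before-↙ c m≢l) (crosses-before-↙ c' m'≢l') rl)
    where open IsDescending D
          rx = parallel D rr (left q e) (left q' e')
  idx-agree D (right q e) (right q' e') rr c c' rl =
    stepIdx-cong (homogeneous rx) (binders-synchronised D rl rx c c')
      (binders-synchronised (converse-descending D) rl rx c' c)
      (λ m≢l m'≢l' → idx-agree D q q' rr (crosses-before-↘ c m≢l) (crosses-before-↘ c' m'≢l') rl)
    where open IsDescending D
          rx = parallel D rr (right q e) (right q' e')

  idx-reflects : ∀ {R} → IsDescending R → ∀ {r r' τ x x' l l'}
    (p : r —[ τ ]→ x) (p' : r' —[ τ ]→ x') → R r r' →
    Crosses kind p l → Crosses kind p' l' → isAbs (kind l) ≡ true → isAbs (kind l') ≡ true →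
    idx kind l p ≡ idx kind l' p' → R l l'
  idx-reflects D ε ε rr c c' _ _ _ with refl ← crosses-ε c | refl ← crosses-ε c' = rr
  idx-reflects D (down q e) (down q' e') rr c c' al al' eq
    with stepIdx-inversion (homogeneous rx) al al' eq
    where open IsDescending D
          rx = parallel D rr (down q e) (down q' e')
  ... | inj₁ (refl , refl) = parallel D rr (down q e) (down q' e')
  ... | inj₂ (m≢l , m'≢l' , eq') =
    idx-reflects D q q' rr (crosses-before-↓ c m≢l) (crosses-before-↓ c' m'≢l') al al' eq'
  idx-reflects D (left q e) (left q' e') rr c c' al al' eq
    with stepIdx-inversion (homogeneous rx) al al' eq
    where open IsDescending D
          rx = parallel D rr (left q e) (left q' e')
  ... | inj₁ (refl , refl) = parallel D rr (left q e) (left q' e')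
  ... | inj₂ (m≢l , m'≢l' , eq') =
    idx-reflects D q q' rr (crosses-before-↙ c m≢l) (crosses-before-↙ c' m'≢l') al al' eq'
  idx-reflects D (right q e) (right q' e') rr c c' al al' eq
    with stepIdx-inversion (homogeneous rx) al al' eq
    where open IsDescending D
          rx = parallel D rr (right q e) (right q' e')
  ... | inj₁ (refl , refl) = parallel D rr (right q e) (right q' e')
  ... | inj₂ (m≢l , m'≢l' , eq') =
    idx-reflects D q q' rr (crosses-before-↘ c m≢l) (crosses-before-↘ c' m'≢l') al al' eq'

  infix 4 ⟦_⟧≡_
  ⟦_⟧≡_ : ∀ {r τ x} → r —[ τ ]→ x → Term → Set
  ⟦ p ⟧≡ t = Readback kind p t

  readback-var⁻¹ : ∀ {r τ x l s} {p : r —[ τ ]→ x} → ⟦ p ⟧≡ s →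
                   kind x ≡ Var l → s ≡ bv (idx kind l p)
  readback-var⁻¹ (rb-var f)     e with refl ← trans (sym f) e = refl
  readback-var⁻¹ (rb-fv f)      e with () ← trans (sym f) e
  readback-var⁻¹ (rb-abs f _)   e with () ← trans (sym f) e
  readback-var⁻¹ (rb-app f _ _) e with () ← trans (sym f) e

  readback-fv⁻¹ : ∀ {r τ x a s} {p : r —[ τ ]→ x} → ⟦ p ⟧≡ s →
                  kind x ≡ FVar a → s ≡ fv a
  readback-fv⁻¹ (rb-var f)     e with () ← trans (sym f) e
  readback-fv⁻¹ (rb-fv f)      e with refl ← trans (sym f) e = refl
  readback-fv⁻¹ (rb-abs f _)   e with () ← trans (sym f) e
  readback-fv⁻¹ (rb-app f _ _) e with () ← trans (sym f) e

  readback-abs⁻¹ : ∀ {r τ x y s} {p : r —[ τ ]→ x} → ⟦ p ⟧≡ s →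
                   (e : kind x ≡ Abs y) → ∃ λ u → s ≡ ƛ u × ⟦ down p e ⟧≡ u
  readback-abs⁻¹ (rb-var f)     e with () ← trans (sym f) e
  readback-abs⁻¹ (rb-fv f)      e with () ← trans (sym f) e
  readback-abs⁻¹ {p = p} (rb-abs f a) e with refl ← trans (sym f) e =
    _ , refl , subst (λ g → ⟦ down p g ⟧≡ _) (uip f e) a
  readback-abs⁻¹ (rb-app f _ _) e with () ← trans (sym f) e

  readback-app⁻¹ : ∀ {r τ x y₁ y₂ s} {p : r —[ τ ]→ x} → ⟦ p ⟧≡ s →
                   (e : kind x ≡ App y₁ y₂) →
                   ∃₂ λ u₁ u₂ → s ≡ u₁ · u₂ × ⟦ left p e ⟧≡ u₁ × ⟦ right p e ⟧≡ u₂
  readback-app⁻¹ (rb-var f)     e with () ← trans (sym f) e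
  readback-app⁻¹ (rb-fv f)      e with () ← trans (sym f) e
  readback-app⁻¹ (rb-abs f _)   e with () ← trans (sym f) e
  readback-app⁻¹ {p = p} (rb-app f a₁ a₂) e with refl ← trans (sym f) e =
    _ , _ , refl , subst (λ g → ⟦ left p g ⟧≡ _) (uip f e) a₁ ,
                   subst (λ g → ⟦ right p g ⟧≡ _) (uip f e) a₂

  readback-kind : ∀ {r τ x s} {p : r —[ τ ]→ x} → ⟦ p ⟧≡ s → kindOf (kind x) ≡ termKind s
  readback-kind (rb-var f)     = cong kindOf f
  readback-kind (rb-fv f)      = cong kindOf f
  readback-kind (rb-abs f _)   = cong kindOf f
  readback-kind (rb-app f _ _) = cong kindOf f

  -- Readback terminates: recursion along a path whose length stays below N.
  readback-exists : ∀ k {r τ x} (p : r —[ τ ]→ x) → N ≤ k + length τ → ∃ λ t → ⟦ p ⟧≡ t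
  readback-exists zero    p N≤ = ⊥-elim (<⇒≱ (path-length< p) N≤)
  readback-exists (suc k) {x = x} p N≤ with kind x in e
  ... | App _ _ with readback-exists k (left p e) N≤′ | readback-exists k (right p e) N≤′
    where N≤′ = subst (N ≤_) (sym (+-suc k _)) N≤
  ... | t₁ , a₁ | t₂ , a₂ = t₁ · t₂ , rb-app e a₁ a₂
  readback-exists (suc k) {x = x} p N≤ | Abs _ with readback-exists k (down p e) N≤′
    where N≤′ = subst (N ≤_) (sym (+-suc k _)) N≤
  ... | t , a = ƛ t , rb-abs e a
  readback-exists (suc k) p _ | FVar a = fv a , rb-fv e
  readback-exists (suc k) p _ | Var l  = bv (idx kind l p) , rb-var e

  root-readback : ∀ r → ∃ λ t → ReadbackRoot G r t
  root-readback r = readback-exists N ε (m≤m+n N 0)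

  module _ {R : Fin N → Fin N → Set} (O : IsOpenBisimulation G R) where
    open IsOpenBisimulation O
    open IsBisimulation bisim

    private
      D : IsDescending R
      D = bisimulation⇒descending bisim

    readback-agree : ∀ {r r' τ x x' s s'} → IsRoot kind r → IsRoot kind r' → R r r' →
                     (p : r —[ τ ]→ x) (p' : r' —[ τ ]→ x') → ⟦ p ⟧≡ s → ⟦ p' ⟧≡ s' → s ≡ s'
    readback-agree rt rt' rr p p' (rb-var e) b
      with _ , e' ← sameKind-Var (homogeneous (parallel D rr p p')) e =
      trans (cong bv (idx-agree D p p' rr (scoped rt p e) (scoped rt' p' e')
                        (var-closed (parallel D rr p p') e e')))
            (sym (readback-var⁻¹ b e'))
    readback-agree rt rt' rr p p' (rb-fv e) b
      with _ , e' ← sameKind-FVar (homogeneous (parallel D rr p p')) e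
      with refl ← open′ (parallel D rr p p') e e' = sym (readback-fv⁻¹ b e)
    readback-agree rt rt' rr p p' (rb-abs e a) b
      with _ , e' ← sameKind-Abs (homogeneous (parallel D rr p p')) e
      with _ , refl , b' ← readback-abs⁻¹ b e' =
      cong ƛ (readback-agree rt rt' rr (down p e) (down p' e') a b')
    readback-agree rt rt' rr p p' (rb-app e a₁ a₂) b
      with _ , _ , e' ← sameKind-App (homogeneous (parallel D rr p p')) e
      with _ , _ , refl , b₁ , b₂ ← readback-app⁻¹ b e' =
      cong₂ _·_ (readback-agree rt rt' rr (left p e) (left p' e') a₁ b₁)
                (readback-agree rt rt' rr (right p e) (right p' e') a₂ b₂)

  parallel-readback : ∀ {r r' τ x x' t} → ⟦ ε {n = r} ⟧≡ t → ⟦ ε {n = r'} ⟧≡ t →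
                      (p : r —[ τ ]→ x) (p' : r' —[ τ ]→ x') → ∃ λ s → ⟦ p ⟧≡ s × ⟦ p' ⟧≡ s
  parallel-readback a a' ε ε = _ , a , a'
  parallel-readback a a' (down q e) (down q' e')
    with _ , b , b' ← parallel-readback a a' q q'
    with u , refl , c ← readback-abs⁻¹ b e | _ , refl , c' ← readback-abs⁻¹ b' e' = u , c , c'
  parallel-readback a a' (left q e) (left q' e')
    with _ , b , b' ← parallel-readback a a' q q'
    with u , _ , refl , c , _ ← readback-app⁻¹ b e | _ , _ , refl , c' , _ ← readback-app⁻¹ b' e' =
    u , c , c'
  parallel-readback a a' (right q e) (right q' e')
    with _ , b , b' ← parallel-readback a a' q q'
    with _ , u , refl , _ , c ← readback-app⁻¹ b e | _ , _ , refl , _ , c' ← readback-app⁻¹ b' e' =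
    u , c , c'

  record Origin (Q : Fin N → Fin N → Set) (x x' : Fin N) : Set where
    constructor origin
    field
      {r r'} : Fin N
      {τ}    : Trace
      query  : Q r r'
      path   : r  —[ τ ]→ x
      path'  : r' —[ τ ]→ x'

  origin-of : ∀ {Q x x'} → _⇓ G Q x x' → Origin Q x x'
  origin-of (base q) = origin q ε ε
  origin-of (appL h e e') with origin q p p' ← origin-of h = origin q (left p e) (left p' e')
  origin-of (appR h e e') with origin q p p' ← origin-of h = origin q (right p e) (right p' e')
  origin-of (abs h e e')  with origin q p p' ← origin-of h = origin q (down p e) (down p' e')

  binder-isAbs : ∀ {v l} → kind v ≡ Var l → isAbs (kind l) ≡ true
  binder-isAbs e = cong isAbs (proj₂ (bind-abs e))

  module _ {Q : Fin N → Fin N → Set} (isQ : IsQuery G Q)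
           (agree : ∀ n m → Q n m → ∃ λ t → ReadbackRoot G n t × ReadbackRoot G m t) where

    common-readback : ∀ {x x'} (o : Origin Q x x') →
                      ∃ λ s → ⟦ Origin.path o ⟧≡ s × ⟦ Origin.path' o ⟧≡ s
    common-readback (origin {r} {r'} q p p') with _ , a , a' ← agree r r' q =
      parallel-readback a a' p p'

    -- Common readbacks have the same head, so Q⇓ is homogeneous, hence descending.
    closure-homogeneous : Homogeneous G (_⇓ G Q)
    closure-homogeneous h with _ , c , c' ← common-readback (origin-of h) =
      trans (readback-kind c) (sym (readback-kind c'))

    closure-descending : IsDescending (_⇓ G Q)
    closure-descending = record
      { homogeneous = closure-homogeneous
      ; app-closed  = λ h e e' → appL h e e' , appR h e e'
      ; abs-closed  = abs }

    -- Equal de Bruijn indices at related variables force related binders.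
    closure-var-closed : ∀ {x x' l l'} → _⇓ G Q x x' → kind x ≡ Var l → kind x' ≡ Var l' →
                         _⇓ G Q l l'
    closure-var-closed h e e' with origin q p p' ← origin-of h
      with _ , c , c' ← common-readback (origin q p p') =
      idx-reflects closure-descending p p' (base q)
        (scoped (proj₁ (isQ q)) p e) (scoped (proj₂ (isQ q)) p' e')
        (binder-isAbs e) (binder-isAbs e')
        (bv-injective (trans (sym (readback-var⁻¹ c e)) (readback-var⁻¹ c' e')))

    -- Equal atoms at related free variables force equal nodes.
    closure-open : ∀ {x x' a b} → _⇓ G Q x x' → kind x ≡ FVar a → kind x' ≡ FVar b → x ≡ x'
    closure-open h e e' with _ , c , c' ← common-readback (origin-of h)
      with refl ← fv-injective (trans (sym (readback-fv⁻¹ c e)) (readback-fv⁻¹ c' e')) =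
      fvar-inj e e'

    closure-open-bisimulation : IsOpenBisimulation G (_⇓ G Q)
    closure-open-bisimulation = record
      { bisim = record
        { homogeneous = closure-homogeneous
        ; app-closed  = IsDescending.app-closed closure-descending
        ; abs-closed  = abs
        ; var-closed  = closure-var-closed }
      ; open′ = closure-open }

mainTheorem18 : ∀ {N : ℕ} (G : LambdaGraph N) (Q : Fin N → Fin N → Set) →
    IsQuery G Q →
    (IsOpenBisimulation G (_⇓ G Q) ⇔
      (∀ n m → Q n m → ∃ λ t → ReadbackRoot G n t × ReadbackRoot G m t))
mainTheorem18 G Q isQ = mk⇔ roots-agree (closure-open-bisimulation G isQ)
  where
    roots-agree : IsOpenBisimulation G (_⇓ G Q) →
                  ∀ n m → Q n m → ∃ λ t → ReadbackRoot G n t × ReadbackRoot G m t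
    roots-agree O n m q with t , a ← root-readback G n | t' , a' ← root-readback G m
      with refl ← readback-agree G O (proj₁ (isQ q)) (proj₂ (isQ q)) (base q) ε ε a a' =
      t , a , a'
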